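{- For a uniformly random NW-convex path of size $n$, viewed as a lattice path from $(0,0)$ with $0$ an east step and $1$ a north step, the expected coordinates $(x_n,y_n)$ of its ending point satisfy $x_n\sim n/2$ and $y_n\sim n/2$ as $n\to\infty$.
   Context: A primitive Christoffel word is associated with coprime integers $(p,q)$, $p\ge0$, $q>0$: it is the word over $\{0,1\}$ coding the highest lattice path from $(0,0)$ to $(p,q)$ staying below the segment joining them ($0$ = east step, $1$ = north step); its length is $p+q$ and its slope $q/p$. A NW-convex path of size $n$ is a finite multiset of primitive Christoffel words of total length $n$, identified with the word obtained by concatenating them in decreasing slope order. -}

module Defs where

open import Data.Bool using (Bool; true; false)
open import Data.Nat using (ℕ; zero; suc; _+_; _*_; _≤_; _<_)
open import Data.Nat.Coprimality using (Coprime)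
open import Data.List using (List; []; _∷_; take; length; map)
open import Data.Nat.ListAction using (sum)
open import Relation.Binary.PropositionalEquality using (_≡_)
open import Data.List.Relation.Unary.All using (All)
open import Data.List.Relation.Unary.Linked using (Linked)
open import Data.List.Relation.Unary.Unique.Propositional using (Unique)
open import Data.List.Membership.Propositional using (_∈_)
open import Data.Product using (Σ; ∃; _×_)
open import Data.Integer using (+_)
open import Data.Rational using (ℚ; _/_)

-- A word over {0,1}: false = 0 = east step, true = 1 = north step.
Word : Set
Word = List Bool

xs : Word → ℕ
xs []           = 0
xs (false ∷ w)  = suc (xs w)
xs (true ∷ w)   = xs w

ys : Word → ℕ
ys []           = 0
ys (true ∷ w)   = suc (ys w)
ys (false ∷ w)  = ys w

BelowPath : ℕ → ℕ → Word → Set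
BelowPath p q w =
  xs w ≡ p × ys w ≡ q × (∀ k → ys (take k w) * p ≤ xs (take k w) * q)

ChristoffelWord : ℕ → ℕ → Word → Set
ChristoffelWord p q w =
  BelowPath p q w × (∀ w' → BelowPath p q w' → ∀ k → ys (take k w') ≤ ys (take k w))

PrimitiveChristoffel : Word → Set
PrimitiveChristoffel w =
  Σ ℕ λ p → Σ ℕ λ q → Coprime p q × 0 < q × ChristoffelWord p q w

-- slope(u) ≥ slope(v), slopes q/p (with q/0 = ∞), compared by cross-multiplication
SlopeGeq : Word → Word → Set
SlopeGeq u v = ys v * xs u ≤ ys u * xs v

-- A NW-convex path of size n: a multiset of primitive Christoffel words of
-- total length n, represented canonically as the list of its words in
-- decreasing (non-increasing) slope order (their concatenation is the path).
NWConvex : ℕ → List Word → Set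
NWConvex n ws =
  All PrimitiveChristoffel ws × Linked SlopeGeq ws × sum (map length ws) ≡ n

endX : List Word → ℕ
endX ws = sum (map xs ws)

endY : List Word → ℕ
endY ws = sum (map ys ws)

Enumerates : ℕ → List (List Word) → Set
Enumerates n L = Unique L × (∀ ws → (ws ∈ L → NWConvex n ws) × (NWConvex n ws → ws ∈ L))

ℕtoℚ : ℕ → ℚ
ℕtoℚ n = (+ n) / 1

-- Let K be the total, over the paths of size n, of the number of leading words 1 (vertical steps).
-- Keeping these and reflecting the rest of the path in its antidiagonal, which exchanges east and north
-- steps, is an involution on the NW-convex paths of size n; hence Σ x + K = Σ y, and with Σ x + Σ y = |L| n
-- both sums are |L| n / 2 ∓ K / 2. It remains to show K = o(|L| n). Trading 2 + j leading words 1 for the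
-- single word 0 1^(j+1) is injective, so K ≤ Σ (1 + m), where m counts the words 0 1^(j+1) in a path.
-- These are distinct, of lengths j + 2, and fit in size n, so q m ≤ q² + n; thus q K < 2 |L| n once n > q + q².

module Submission where

open import Defs

module LatticePaths where
  open import Data.Bool using (true; false; not)
  import Data.Bool as Bool
  open import Data.Bool.Properties using (not-involutive)
  open import Data.Nat using (ℕ; zero; suc; pred; _+_; _*_; _∸_; _⊓_; _≤_; _<_; z≤n; s≤s; _≤?_; _<?_; NonZero)
  open import Data.Nat.Properties
  open import Data.List using (List; []; _∷_; _++_; _ʳ++_; filter; downFrom; take; drop; length; map; reverse; replicate)
  open import Data.List.Properties
    using (map-++; map-∘; map-cong; map-id; length-map; length-reverse; length-take; length-drop;
           unfold-reverse; reverse-++; reverse-map; reverse-involutive; take-all; take++drop≡id; drop-map;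
           map-id-local; ≡-dec; ++-identityʳ)
  open import Relation.Binary.PropositionalEquality
  open import Relation.Nullary using (Dec; yes; no)
  open import Relation.Unary using (Decidable)
  open import Data.Sum using (inj₁; inj₂)
  open import Data.Product using (_×_; _,_; proj₁; proj₂; map₁)
  open import Data.Empty using (⊥-elim)
  open import Function using (flip; _∘_)
  open import Data.List.Relation.Unary.All using (All; []; _∷_)
  import Data.List.Relation.Unary.All as All
  import Data.List.Relation.Unary.All.Properties as All
  open import Data.List.Relation.Unary.Linked as Linked using (Linked; []; [-]; _∷_)
  import Data.List.Relation.Unary.Linked.Properties as Linked
  import Data.Nat.Coprimality as Coprime
  open import Data.Nat.ListAction using (sum)
  open import Algebra.Properties.CommutativeSemigroup +-commutativeSemigroup using (interchange; x∙yz≈y∙xz)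
  open import Algebra.Properties.CommutativeSemigroup *-commutativeSemigroup using () renaming (x∙yz≈y∙xz to x*yz≡y*xz)
  open import Data.Nat.ListAction.Properties using (sum-++; sum-↭)
  open import Data.List.Relation.Binary.Permutation.Propositional using (_↭_; ↭-sym)
  open import Data.List.Relation.Binary.Permutation.Propositional.Properties using (↭-reverse; All-resp-↭)
  import Data.List.Relation.Binary.Permutation.Propositional.Properties as ↭
  open import Data.List.Relation.Binary.BagAndSetEquality using (∼bag⇒↭)
  open import Data.List.Membership.Propositional using (_∈_)
  open import Data.List.Membership.Propositional.Properties
    using (∈-map⁺; ∈-map⁻; ∈-++⁻; ∈-++⁺ˡ; ∈-++⁺ʳ; ∈-∃++; ∈-filter⁺; ∈-filter⁻)
  open import Data.List.Membership.Propositional.Properties.WithK using (unique∧set⇒bag)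
  open import Data.List.Relation.Unary.Unique.Propositional using (Unique)
  open import Data.List.Relation.Unary.AllPairs using ([]; _∷_)
  import Data.List.Relation.Unary.Unique.Propositional.Properties as Unique
  open import Data.List.Relation.Unary.Any using (here; there)
  open import Function.Bundles using (mk⇔)

  sum-map-++ : ∀ {A : Set} (f : A → ℕ) as bs → sum (map f (as ++ bs)) ≡ sum (map f as) + sum (map f bs)
  sum-map-++ f as bs = trans (cong sum (map-++ f as bs)) (sum-++ (map f as) (map f bs))

  sum-map-reverse : ∀ {A : Set} (f : A → ℕ) as → sum (map f (reverse as)) ≡ sum (map f as)
  sum-map-reverse f as = trans (cong sum (reverse-map f as)) (sum-↭ (↭-reverse (map f as)))

  sum-map-replicate : ∀ {A : Set} (f : A → ℕ) k x → sum (map f (replicate k x)) ≡ k * f x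
  sum-map-replicate f zero    x = refl
  sum-map-replicate f (suc k) x = cong (f x +_) (sum-map-replicate f k x)

  sum-map-const : ∀ {A : Set} (c : ℕ) (as : List A) → sum (map (λ _ → c) as) ≡ length as * c
  sum-map-const c []       = refl
  sum-map-const c (x ∷ as) = cong (c +_) (sum-map-const c as)

  sum-map-cong : ∀ {A : Set} {f g : A → ℕ} → f ≗ g → ∀ as → sum (map f as) ≡ sum (map g as)
  sum-map-cong f≗g as = cong sum (map-cong f≗g as)

  sum-map-cong-∈ : ∀ {A : Set} {f g : A → ℕ} as → (∀ {x} → x ∈ as → f x ≡ g x) → sum (map f as) ≡ sum (map g as)
  sum-map-cong-∈ []       _   = refl
  sum-map-cong-∈ (x ∷ as) f≡g = cong₂ _+_ (f≡g (here refl)) (sum-map-cong-∈ as (f≡g ∘ there))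

  sum-map-∘ : ∀ {A B : Set} (f : B → ℕ) (g : A → B) as → sum (map f (map g as)) ≡ sum (map (λ x → f (g x)) as)
  sum-map-∘ f g as = cong sum (sym (map-∘ as))

  sum-map-+ : ∀ {A : Set} (f g : A → ℕ) as → sum (map (λ x → f x + g x) as) ≡ sum (map f as) + sum (map g as)
  sum-map-+ f g []       = refl
  sum-map-+ f g (x ∷ as) = trans (cong (f x + g x +_) (sum-map-+ f g as))
    (interchange (f x) (g x) (sum (map f as)) (sum (map g as)))

  sum-map-*ˡ : ∀ {A : Set} (c : ℕ) (f : A → ℕ) as → sum (map (λ x → c * f x) as) ≡ c * sum (map f as)
  sum-map-*ˡ c f []       = sym (*-zeroʳ c)
  sum-map-*ˡ c f (x ∷ as) = trans (cong (c * f x +_) (sum-map-*ˡ c f as)) (sym (*-distribˡ-+ c (f x) _))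

  sum-map-mono : ∀ {A : Set} {f g : A → ℕ} as → (∀ {x} → x ∈ as → f x ≤ g x) → sum (map f as) ≤ sum (map g as)
  sum-map-mono []       _    = z≤n
  sum-map-mono (x ∷ as) f≤g = +-mono-≤ (f≤g (here refl)) (sum-map-mono as (f≤g ∘ there))

  sum-map-swap : ∀ {A B : Set} (g : A → B → ℕ) as bs →
                 sum (map (λ x → sum (map (g x) bs)) as) ≡ sum (map (λ y → sum (map (λ x → g x y) as)) bs)
  sum-map-swap g []       bs = sym (trans (sum-map-const 0 bs) (*-zeroʳ (length bs)))
  sum-map-swap g (x ∷ as) bs =
    trans (cong (sum (map (g x) bs) +_) (sum-map-swap g as bs))
          (sym (sum-map-+ (g x) (λ y → sum (map (λ x′ → g x′ y) as)) bs))

  ∈-delete : ∀ {A : Set} {x y : A} as bs → x ∈ as ++ y ∷ bs → x ≢ y → x ∈ as ++ bs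
  ∈-delete as bs x∈ x≢y with ∈-++⁻ as x∈
  ... | inj₁ x∈as        = ∈-++⁺ˡ x∈as
  ... | inj₂ (here x≡y)  = ⊥-elim (x≢y x≡y)
  ... | inj₂ (there x∈bs) = ∈-++⁺ʳ as x∈bs

  sum-map-mono-⊆ : ∀ {A : Set} (f : A → ℕ) {as bs : List A} → Unique as → (∀ {x} → x ∈ as → x ∈ bs) →
                   sum (map f as) ≤ sum (map f bs)
  sum-map-mono-⊆ f {[]}     _               _     = z≤n
  sum-map-mono-⊆ f {x ∷ as} (x∉as ∷ unique) as⊆bs with ∈-∃++ (as⊆bs (here refl))
  ... | cs , ds , refl = begin
    f x + sum (map f as)                       ≤⟨ +-monoʳ-≤ (f x) (sum-map-mono-⊆ f unique as⊆cs++ds) ⟩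
    f x + sum (map f (cs ++ ds))               ≡⟨ cong (f x +_) (sum-map-++ f cs ds) ⟩
    f x + (sum (map f cs) + sum (map f ds))    ≡⟨ x∙yz≈y∙xz (f x) (sum (map f cs)) (sum (map f ds)) ⟩
    sum (map f cs) + (f x + sum (map f ds))    ≡⟨ sum-map-++ f cs (x ∷ ds) ⟨
    sum (map f (cs ++ x ∷ ds))                 ∎
    where
    open ≤-Reasoning
    as⊆cs++ds : ∀ {y} → y ∈ as → y ∈ cs ++ ds
    as⊆cs++ds y∈as = ∈-delete cs ds (as⊆bs (there y∈as)) (λ y≡x → All.lookup x∉as y∈as (sym y≡x))

  𝟙 : ∀ {a} {A : Set a} → Dec A → ℕ
  𝟙 (yes _) = 1
  𝟙 (no _)  = 0

  sum-𝟙*≡sum-filter : ∀ {A : Set} {P : A → Set} (P? : Decidable P) (f : A → ℕ) as →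
                      sum (map (λ x → 𝟙 (P? x) * f x) as) ≡ sum (map f (filter P? as))
  sum-𝟙*≡sum-filter P? f []       = refl
  sum-𝟙*≡sum-filter P? f (x ∷ as) with P? x
  ... | yes _ = cong₂ _+_ (+-identityʳ (f x)) (sum-𝟙*≡sum-filter P? f as)
  ... | no _  = sum-𝟙*≡sum-filter P? f as

  count≡size-filter : ∀ {A : Set} {P : A → Set} (P? : Decidable P) as →
                      sum (map (λ x → 𝟙 (P? x)) as) ≡ sum (map (λ _ → 1) (filter P? as))
  count≡size-filter P? as =
    trans (sum-map-cong (λ x → sym (*-identityʳ (𝟙 (P? x)))) as) (sum-𝟙*≡sum-filter P? (λ _ → 1) as)

  count-≤-injection : ∀ {A : Set} {P Q : A → Set} (P? : Decidable P) (Q? : Decidable Q) (g h : A → A) {as} →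
                      Unique as → (∀ {x} → x ∈ as → P x → g x ∈ as × Q (g x) × h (g x) ≡ x) →
                      sum (map (λ x → 𝟙 (P? x)) as) ≤ sum (map (λ x → 𝟙 (Q? x)) as)
  count-≤-injection P? Q? g h {as} unique injection = begin
    sum (map (λ x → 𝟙 (P? x)) as)               ≡⟨ count≡size-filter P? as ⟩
    sum (map (λ _ → 1) (filter P? as))           ≡⟨ sum-map-∘ (λ _ → 1) g (filter P? as) ⟨
    sum (map (λ _ → 1) (map g (filter P? as)))   ≤⟨ sum-map-mono-⊆ (λ _ → 1) unique-image image⊆ ⟩
    sum (map (λ _ → 1) (filter Q? as))           ≡⟨ count≡size-filter Q? as ⟨
    sum (map (λ x → 𝟙 (Q? x)) as)               ∎
    where
    open ≤-Reasoning
    hg≡id : ∀ {x} → x ∈ filter P? as → h (g x) ≡ x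
    hg≡id x∈ = let (x∈as , px) = ∈-filter⁻ P? x∈ in proj₂ (proj₂ (injection x∈as px))
    unique-image : Unique (map g (filter P? as))
    unique-image = Unique.map⁻ (subst Unique (sym (trans (sym (map-∘ {g = h} {f = g} (filter P? as)))
                                                         (map-id-local (All.tabulate hg≡id))))
                                                (Unique.filter⁺ P? unique))
    image⊆ : ∀ {y} → y ∈ map g (filter P? as) → y ∈ filter Q? as
    image⊆ y∈ with ∈-map⁻ g y∈
    ... | x , x∈ , refl = let (x∈as , px) = ∈-filter⁻ P? x∈ ; (gx∈as , qgx , _) = injection x∈as px
                          in ∈-filter⁺ Q? gx∈as qgx

  count-<-downFrom : ∀ n m → sum (map (λ j → 𝟙 (j <? m)) (downFrom n)) ≡ n ⊓ m
  count-<-downFrom zero    m = refl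
  count-<-downFrom (suc n) m with n <? m
  ... | yes n<m = trans (cong suc (trans (count-<-downFrom n m) (m≤n⇒m⊓n≡m (<⇒≤ n<m)))) (sym (m≤n⇒m⊓n≡m n<m))
  ... | no n≮m  = trans (count-<-downFrom n m)
                    (trans (m≥n⇒m⊓n≡n (≮⇒≥ n≮m)) (sym (m≥n⇒m⊓n≡n (≤-trans (≮⇒≥ n≮m) (n≤1+n n)))))

  take-++-length : ∀ {A : Set} (as bs : List A) → take (length as) (as ++ bs) ≡ as
  take-++-length []       bs = refl
  take-++-length (x ∷ as) bs = cong (x ∷_) (take-++-length as bs)

  take-reverse : ∀ {A : Set} k (as : List A) → take k (reverse as) ≡ reverse (drop (length as ∸ k) as)
  take-reverse k as with length as ≤? k
  ... | yes as≤k rewrite m≤n⇒m∸n≡0 as≤k =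
    take-all k (reverse as) (≤-trans (≤-reflexive (length-reverse as)) as≤k)
  ... | no as≰k = begin
    take k (reverse as)                                 ≡⟨ cong (λ bs → take k (reverse bs)) (take++drop≡id j as) ⟨
    take k (reverse (take j as ++ drop j as))           ≡⟨ cong (take k) (reverse-++ (take j as) (drop j as)) ⟩
    take k (reverse (drop j as) ++ reverse (take j as))
                                                        ≡⟨ cong (λ i → take i (reverse (drop j as) ++ reverse (take j as))) length-suffix ⟨
    take (length (reverse (drop j as))) (reverse (drop j as) ++ reverse (take j as))
                                                        ≡⟨ take-++-length (reverse (drop j as)) _ ⟩
    reverse (drop j as)                                 ∎
    where
    open ≡-Reasoning
    j = length as ∸ k
    length-suffix : length (reverse (drop j as)) ≡ k
    length-suffix = trans (length-reverse (drop j as)) (trans (length-drop j as) (m∸[m∸n]≡n (≰⇒≥ as≰k)))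

  additive-reverse : ∀ {A : Set} (f : List A → ℕ) → (∀ as bs → f (as ++ bs) ≡ f as + f bs) →
                     ∀ as → f (reverse as) ≡ f as
  additive-reverse f f-++ []       = refl
  additive-reverse f f-++ (x ∷ as) = begin
    f (reverse (x ∷ as))         ≡⟨ cong f (unfold-reverse x as) ⟩
    f (reverse as ++ x ∷ [])     ≡⟨ f-++ (reverse as) (x ∷ []) ⟩
    f (reverse as) + f (x ∷ [])  ≡⟨ cong (_+ f (x ∷ [])) (additive-reverse f f-++ as) ⟩
    f as + f (x ∷ [])            ≡⟨ +-comm (f as) _ ⟩
    f (x ∷ []) + f as            ≡⟨ f-++ (x ∷ []) as ⟨
    f (x ∷ as)                   ∎
    where open ≡-Reasoning

  Linked-reverse : ∀ {A : Set} {R : A → A → Set} {as} → Linked (flip R) as → Linked R (reverse as)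
  Linked-reverse {as = []}     _       = []
  Linked-reverse {as = x ∷ as} ordered = go as [-] ordered
    where
    go : ∀ {A : Set} {R : A → A → Set} {y acc} as → Linked R (y ∷ acc) → Linked (flip R) (y ∷ as) →
         Linked R (as ʳ++ (y ∷ acc))
    go []       acc-ordered _                = acc-ordered
    go (z ∷ zs) acc-ordered (z≤y ∷ ordered) = go zs (z≤y ∷ acc-ordered) ordered

  Linked-drop : ∀ {A : Set} {R : A → A → Set} m {as} → Linked R as → Linked R (drop m as)
  Linked-drop zero    ordered         = ordered
  Linked-drop (suc m) {[]}    _       = []
  Linked-drop (suc m) {_ ∷ _} ordered = Linked-drop m (Linked.tail ordered)

  map-involution-↭ : ∀ {A : Set} {g : A → A} {L : List A} → Unique L →
                     (∀ {x} → x ∈ L → g x ∈ L) → (∀ {x} → x ∈ L → g (g x) ≡ x) → map g L ↭ L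
  map-involution-↭ {g = g} {L} unique closed involutive = ∼bag⇒↭ (unique∧set⇒bag unique-image unique (mk⇔ to from))
    where
    map-g-g : map g (map g L) ≡ L
    map-g-g = trans (sym (map-∘ L)) (map-id-local (All.tabulate involutive))
    unique-image : Unique (map g L)
    unique-image = Unique.map⁻ (subst Unique (sym map-g-g) unique)
    to : ∀ {x} → x ∈ map g L → x ∈ L
    to x∈gL with ∈-map⁻ g x∈gL
    ... | y , y∈L , refl = closed y∈L
    from : ∀ {x} → x ∈ L → x ∈ map g L
    from x∈L = subst (_∈ map g _) (involutive x∈L) (∈-map⁺ g (closed x∈L))

  xs-++ : ∀ u v → xs (u ++ v) ≡ xs u + xs v
  xs-++ []          v = refl
  xs-++ (false ∷ u) v = cong suc (xs-++ u v)
  xs-++ (true ∷ u)  v = xs-++ u v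

  ys-++ : ∀ u v → ys (u ++ v) ≡ ys u + ys v
  ys-++ []          v = refl
  ys-++ (true ∷ u)  v = cong suc (ys-++ u v)
  ys-++ (false ∷ u) v = ys-++ u v

  xs+ys≡length : ∀ u → xs u + ys u ≡ length u
  xs+ys≡length []          = refl
  xs+ys≡length (false ∷ u) = cong suc (xs+ys≡length u)
  xs+ys≡length (true ∷ u)  = trans (+-suc (xs u) (ys u)) (cong suc (xs+ys≡length u))

  xs-take+xs-drop : ∀ j u → xs (take j u) + xs (drop j u) ≡ xs u
  xs-take+xs-drop j u = trans (sym (xs-++ (take j u) (drop j u))) (cong xs (take++drop≡id j u))

  ys-take+ys-drop : ∀ j u → ys (take j u) + ys (drop j u) ≡ ys u
  ys-take+ys-drop j u = trans (sym (ys-++ (take j u) (drop j u))) (cong ys (take++drop≡id j u))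

  xs-map-not : ∀ u → xs (map not u) ≡ ys u
  xs-map-not []          = refl
  xs-map-not (false ∷ u) = xs-map-not u
  xs-map-not (true ∷ u)  = cong suc (xs-map-not u)

  ys-map-not : ∀ u → ys (map not u) ≡ xs u
  ys-map-not []          = refl
  ys-map-not (true ∷ u)  = ys-map-not u
  ys-map-not (false ∷ u) = cong suc (ys-map-not u)

  -- For a path to (p, q) this is its image under the reflection (x, y) ↦ (q − y, p − x).
  mirror : Word → Word
  mirror u = reverse (map not u)

  xs-mirror : ∀ u → xs (mirror u) ≡ ys u
  xs-mirror u = trans (additive-reverse xs xs-++ (map not u)) (xs-map-not u)

  ys-mirror : ∀ u → ys (mirror u) ≡ xs u
  ys-mirror u = trans (additive-reverse ys ys-++ (map not u)) (ys-map-not u)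

  length-mirror : ∀ u → length (mirror u) ≡ length u
  length-mirror u = trans (length-reverse (map not u)) (length-map not u)

  mirror-involutive : ∀ u → mirror (mirror u) ≡ u
  mirror-involutive u = begin
    reverse (map not (reverse (map not u))) ≡⟨ cong reverse (reverse-map not (map not u)) ⟩
    reverse (reverse (map not (map not u))) ≡⟨ reverse-involutive _ ⟩
    map not (map not u)                     ≡⟨ map-∘ u ⟨
    map (λ b → not (not b)) u               ≡⟨ map-cong not-involutive u ⟩
    map (λ b → b) u                         ≡⟨ map-id u ⟩
    u                                       ∎
    where open ≡-Reasoning

  take-mirror : ∀ k u → take k (mirror u) ≡ mirror (drop (length u ∸ k) u)
  take-mirror k u = begin
    take k (reverse (map not u))                             ≡⟨ take-reverse k (map not u) ⟩
    reverse (drop (length (map not u) ∸ k) (map not u))      ≡⟨ cong (λ l → reverse (drop (l ∸ k) (map not u))) (length-map not u) ⟩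
    reverse (drop (length u ∸ k) (map not u))                ≡⟨ cong reverse (drop-map (length u ∸ k) u) ⟩
    mirror (drop (length u ∸ k) u)                           ∎
    where open ≡-Reasoning

  ys-take-mirror : ∀ k u → ys (take k (mirror u)) ≡ xs (drop (length u ∸ k) u)
  ys-take-mirror k u = trans (cong ys (take-mirror k u)) (ys-mirror (drop (length u ∸ k) u))

  xs-take-mirror : ∀ k u → xs (take k (mirror u)) ≡ ys (drop (length u ∸ k) u)
  xs-take-mirror k u = trans (cong xs (take-mirror k u)) (xs-mirror (drop (length u ∸ k) u))

  -- Christoffel words

  -- If a prefix of a path to (p, q) is weakly below the diagonal, the rest of the path is weakly above it.
  cross-complement : ∀ {a a′ b b′ p q} → a + a′ ≡ p → b + b′ ≡ q → b * p ≤ a * q → a′ * q ≤ b′ * p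
  cross-complement {a} {a′} {b} {b′} {p} {q} refl refl bp≤aq = +-cancelˡ-≤ (a * q) _ _ (begin
    a * q + a′ * q   ≡⟨ *-distribʳ-+ q a a′ ⟨
    (a + a′) * q     ≡⟨ *-comm (a + a′) q ⟩
    q * (a + a′)     ≡⟨ *-distribʳ-+ (a + a′) b b′ ⟩
    b * p + b′ * p   ≤⟨ +-monoˡ-≤ (b′ * p) bp≤aq ⟩
    a * q + b′ * p   ∎)
    where open ≤-Reasoning

  xs-drop-≤ : ∀ j {v w} → length v ≡ length w → xs v ≡ xs w →
              ys (take j v) ≤ ys (take j w) → xs (drop j v) ≤ xs (drop j w)
  xs-drop-≤ j {v} {w} |v|≡|w| xv≡xw lower = +-cancelˡ-≤ (xs (take j v)) _ _ (begin
    xs (take j v) + xs (drop j v) ≡⟨ xs-take+xs-drop j v ⟩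
    xs v                          ≡⟨ xv≡xw ⟩
    xs w                          ≡⟨ xs-take+xs-drop j w ⟨
    xs (take j w) + xs (drop j w) ≤⟨ +-monoˡ-≤ _ more-east ⟩
    xs (take j v) + xs (drop j w) ∎)
    where
    open ≤-Reasoning
    same-length : xs (take j v) + ys (take j v) ≡ xs (take j w) + ys (take j w)
    same-length = begin-equality
      xs (take j v) + ys (take j v) ≡⟨ xs+ys≡length (take j v) ⟩
      length (take j v)             ≡⟨ length-take j v ⟩
      j ⊓ length v                  ≡⟨ cong (j ⊓_) |v|≡|w| ⟩
      j ⊓ length w                  ≡⟨ length-take j w ⟨
      length (take j w)             ≡⟨ xs+ys≡length (take j w) ⟨
      xs (take j w) + ys (take j w) ∎
    more-east : xs (take j w) ≤ xs (take j v)
    more-east = +-cancelʳ-≤ (ys (take j v)) _ _ (begin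
      xs (take j w) + ys (take j v) ≤⟨ +-monoʳ-≤ _ lower ⟩
      xs (take j w) + ys (take j w) ≡⟨ same-length ⟨
      xs (take j v) + ys (take j v) ∎)

  length-below : ∀ {p q w} → BelowPath p q w → length w ≡ p + q
  length-below {w = w} (refl , refl , _) = sym (xs+ys≡length w)

  below-mirror : ∀ {p q w} → BelowPath p q w → BelowPath q p (mirror w)
  below-mirror {p} {q} {w} (xw≡p , yw≡q , below) =
    trans (xs-mirror w) yw≡q , trans (ys-mirror w) xw≡p , λ k →
      let j = length w ∸ k in
      subst₂ (λ s t → s * q ≤ t * p) (sym (ys-take-mirror k w)) (sym (xs-take-mirror k w))
        (cross-complement {xs (take j w)} {xs (drop j w)} {ys (take j w)} {ys (drop j w)}
           (trans (xs-take+xs-drop j w) xw≡p) (trans (ys-take+ys-drop j w) yw≡q) (below j))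

  christoffel-mirror : ∀ {p q w} → ChristoffelWord p q w → ChristoffelWord q p (mirror w)
  christoffel-mirror {p} {q} {w} (w-below , w-highest) = below-mirror w-below , highest
    where
    highest : ∀ v → BelowPath q p v → ∀ k → ys (take k v) ≤ ys (take k (mirror w))
    highest v v-below k = begin
      ys (take k v)                                ≡⟨ cong (λ z → ys (take k z)) (mirror-involutive v) ⟨
      ys (take k (mirror v′))                      ≡⟨ ys-take-mirror k v′ ⟩
      xs (drop (length v′ ∸ k) v′)                 ≡⟨ cong (λ l → xs (drop (l ∸ k) v′)) |v′|≡|w| ⟩
      xs (drop j v′)                               ≤⟨ xs-drop-≤ j |v′|≡|w| (trans (proj₁ v′-below) (sym (proj₁ w-below)))
                                                       (w-highest v′ v′-below j) ⟩
      xs (drop j w)                                ≡⟨ ys-take-mirror k w ⟨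
      ys (take k (mirror w))                       ∎
      where
      open ≤-Reasoning
      v′ = mirror v
      v′-below = below-mirror v-below
      j = length w ∸ k
      |v′|≡|w| : length v′ ≡ length w
      |v′|≡|w| = trans (length-below v′-below) (sym (length-below w-below))

  ys-take-≤ : ∀ k v → ys (take k v) ≤ k ⊓ ys v
  ys-take-≤ zero    v           = z≤n
  ys-take-≤ (suc k) []          = z≤n
  ys-take-≤ (suc k) (true ∷ v)  = s≤s (ys-take-≤ k v)
  ys-take-≤ (suc k) (false ∷ v) = ≤-trans (ys-take-≤ k v) (⊓-monoˡ-≤ (ys v) (n≤1+n k))

  ys-take-replicate-true : ∀ k m → ys (take k (replicate m true)) ≡ k ⊓ m
  ys-take-replicate-true zero    m       = refl
  ys-take-replicate-true (suc k) zero    = refl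
  ys-take-replicate-true (suc k) (suc m) = cong suc (ys-take-replicate-true k m)

  xs-take-replicate-true : ∀ k m → xs (take k (replicate m true)) ≡ 0
  xs-take-replicate-true zero    m       = refl
  xs-take-replicate-true (suc k) zero    = refl
  xs-take-replicate-true (suc k) (suc m) = xs-take-replicate-true k m

  xs-replicate-true : ∀ m → xs (replicate m true) ≡ 0
  xs-replicate-true zero    = refl
  xs-replicate-true (suc m) = xs-replicate-true m

  ys-replicate-true : ∀ m → ys (replicate m true) ≡ m
  ys-replicate-true zero    = refl
  ys-replicate-true (suc m) = cong suc (ys-replicate-true m)

  replicate-true-highest : ∀ k m v → ys v ≡ m → ys (take k v) ≤ ys (take k (replicate m true))
  replicate-true-highest k m v refl = ≤-trans (ys-take-≤ k v) (≤-reflexive (sym (ys-take-replicate-true k (ys v))))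

  north : Word
  north = true ∷ []

  primitive-north : PrimitiveChristoffel north
  primitive-north = 0 , 1 , Coprime.sym (Coprime.1-coprimeTo 0) , s≤s z≤n , (north-below , highest)
    where
    north-below : BelowPath 0 1 north
    north-below = refl , refl , λ k → subst (_≤ xs (take k north) * 1) (sym (*-zeroʳ (ys (take k north)))) z≤n
    highest : ∀ v → BelowPath 0 1 v → ∀ k → ys (take k v) ≤ ys (take k north)
    highest v (_ , yv≡1 , _) k = replicate-true-highest k 1 v yv≡1

  eastThenNorth : ℕ → Word
  eastThenNorth j = false ∷ replicate (suc j) true

  length-eastThenNorth : ∀ j → length (eastThenNorth j) ≡ suc (suc j)
  length-eastThenNorth j = cong suc (Data.List.Properties.length-replicate (suc j))

  eastThenNorth-injective : ∀ {i j} → eastThenNorth i ≡ eastThenNorth j → i ≡ j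
  eastThenNorth-injective {i} {j} e =
    suc-injective (suc-injective (trans (sym (length-eastThenNorth i)) (trans (cong length e) (length-eastThenNorth j))))

  primitive-eastThenNorth : ∀ j → PrimitiveChristoffel (eastThenNorth j)
  primitive-eastThenNorth j = 1 , suc j , Coprime.1-coprimeTo (suc j) , s≤s z≤n , (below , highest)
    where
    below : BelowPath 1 (suc j) (eastThenNorth j)
    below = cong suc (xs-replicate-true j) , cong suc (ys-replicate-true j) , λ
      { zero    → z≤n
      ; (suc k) → subst₂ _≤_ (sym (*-identityʳ _)) (cong (λ x → suc x * suc j) (sym (xs-take-replicate-true k (suc j))))
                    (≤-trans (≤-reflexive (ys-take-replicate-true k (suc j))) (≤-trans (m⊓n≤n k (suc j)) (m≤m+n (suc j) 0))) }
    highest : ∀ v → BelowPath 1 (suc j) v → ∀ k → ys (take k v) ≤ ys (take k (eastThenNorth j))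
    highest v           _                zero    = z≤n
    highest []          (() , _)         (suc k)
    highest (true ∷ v)  (_ , _ , below′) (suc k) with below′ 1
    ... | ()
    highest (false ∷ v) (_ , yv≡q , _)   (suc k) = replicate-true-highest k (suc j) v yv≡q

  0<ys-primitive : ∀ {w} → PrimitiveChristoffel w → 0 < ys w
  0<ys-primitive (_ , _ , _ , 0<q , (_ , refl , _) , _) = 0<q

  primitive-xs≡0 : ∀ {w} → PrimitiveChristoffel w → xs w ≡ 0 → w ≡ north
  primitive-xs≡0 {w} (p , q , coprime , _ , (xw≡p , yw≡q , _) , _) xw≡0 =
    word-0-1 w xw≡0 (trans yw≡q (Coprime.0-coprimeTo-m⇒m≡1 (subst (λ x → Coprime.Coprime x q) (trans (sym xw≡p) xw≡0) coprime)))
    where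
    word-0-1 : ∀ w → xs w ≡ 0 → ys w ≡ 1 → w ≡ north
    word-0-1 (true ∷ [])         _  _  = refl
    word-0-1 (true ∷ true ∷ w)   _  ()
    word-0-1 (true ∷ false ∷ w)  ()
    word-0-1 (false ∷ w)         ()
    word-0-1 []                  _  ()

  primitive-mirror : ∀ {w} → PrimitiveChristoffel w → w ≢ north → PrimitiveChristoffel (mirror w)
  primitive-mirror {w} prim@(p , q , coprime , _ , chr@((xw≡p , _ , _) , _)) w≢north =
    q , p , Coprime.sym coprime , subst (0 <_) xw≡p (n≢0⇒n>0 (λ xw≡0 → w≢north (primitive-xs≡0 prim xw≡0))) ,
    christoffel-mirror chr

  mirror-≢-north : ∀ {w} → PrimitiveChristoffel w → mirror w ≢ north
  mirror-≢-north {w} prim mirror≡north =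
    <-irrefl (sym (trans (sym (xs-mirror w)) (cong xs mirror≡north))) (0<ys-primitive prim)

  slope-≥-north : ∀ {v} → PrimitiveChristoffel v → SlopeGeq v north → v ≡ north
  slope-≥-north {v} prim v≥north =
    primitive-xs≡0 prim (n≤0⇒n≡0 (subst₂ _≤_ (+-identityʳ (xs v)) (*-zeroʳ (ys v)) v≥north))

  north-slope-≥ : ∀ v → SlopeGeq north v
  north-slope-≥ v = subst (_≤ xs v + 0) (sym (*-zeroʳ (ys v))) z≤n

  mirror-slope : ∀ {u v} → SlopeGeq u v → SlopeGeq (mirror v) (mirror u)
  mirror-slope {u} {v} u≥v = subst₂ _≤_
    (trans (*-comm (ys v) (xs u)) (sym (cong₂ _*_ (ys-mirror u) (xs-mirror v))))
    (trans (*-comm (ys u) (xs v)) (sym (cong₂ _*_ (ys-mirror v) (xs-mirror u))))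
    u≥v

  -- The leading vertical block and the reflection

  PrimitiveNonNorth : Word → Set
  PrimitiveNonNorth w = PrimitiveChristoffel w × w ≢ north

  leadingNorths : List Word → ℕ
  leadingNorths []                     = 0
  leadingNorths ([] ∷ ws)              = 0
  leadingNorths ((false ∷ w) ∷ ws)     = 0
  leadingNorths ((true ∷ []) ∷ ws)     = suc (leadingNorths ws)
  leadingNorths ((true ∷ b ∷ w) ∷ ws)  = 0

  afterNorths : List Word → List Word
  afterNorths ws = drop (leadingNorths ws) ws

  take-leadingNorths : ∀ m ws → m ≤ leadingNorths ws → take m ws ≡ replicate m north
  take-leadingNorths zero    ws                      _         = refl
  take-leadingNorths (suc m) ((true ∷ []) ∷ ws)      (s≤s m≤l) = cong (north ∷_) (take-leadingNorths m ws m≤l)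
  take-leadingNorths (suc m) []                      ()
  take-leadingNorths (suc m) ([] ∷ ws)               ()
  take-leadingNorths (suc m) ((false ∷ w) ∷ ws)      ()
  take-leadingNorths (suc m) ((true ∷ b ∷ w) ∷ ws)   ()

  north-block++drop : ∀ m ws → m ≤ leadingNorths ws → replicate m north ++ drop m ws ≡ ws
  north-block++drop m ws m≤l = trans (cong (_++ drop m ws) (sym (take-leadingNorths m ws m≤l))) (take++drop≡id m ws)

  north-block++afterNorths : ∀ ws → replicate (leadingNorths ws) north ++ afterNorths ws ≡ ws
  north-block++afterNorths ws = north-block++drop (leadingNorths ws) ws ≤-refl

  split-north-block : ∀ k {vs} → All (_≢ north) vs →
                      leadingNorths (replicate k north ++ vs) ≡ k × afterNorths (replicate k north ++ vs) ≡ vs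
  split-north-block (suc k) vs≢north = map₁ (cong suc) (split-north-block k vs≢north)
  split-north-block zero {[]}                    _              = refl , refl
  split-north-block zero {[] ∷ vs}               _              = refl , refl
  split-north-block zero {(false ∷ w) ∷ vs}      _              = refl , refl
  split-north-block zero {(true ∷ []) ∷ vs}      (v≢north ∷ _)  = ⊥-elim (v≢north refl)
  split-north-block zero {(true ∷ b ∷ w) ∷ vs}   _              = refl , refl

  sum-map-north-block : ∀ (f : Word → ℕ) ws → sum (map f ws) ≡ leadingNorths ws * f north + sum (map f (afterNorths ws))
  sum-map-north-block f ws = begin
    sum (map f ws)                                         ≡⟨ cong (λ vs → sum (map f vs)) (north-block++afterNorths ws) ⟨
    sum (map f (replicate k north ++ afterNorths ws))       ≡⟨ sum-map-++ f (replicate k north) (afterNorths ws) ⟩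
    sum (map f (replicate k north)) + sum (map f (afterNorths ws))
                                                           ≡⟨ cong (_+ sum (map f (afterNorths ws))) (sum-map-replicate f k north) ⟩
    k * f north + sum (map f (afterNorths ws))              ∎
    where
    open ≡-Reasoning
    k = leadingNorths ws

  all-nonNorth : ∀ {v vs} → All PrimitiveChristoffel (v ∷ vs) → Linked SlopeGeq (v ∷ vs) → v ≢ north →
                 All PrimitiveNonNorth (v ∷ vs)
  all-nonNorth (pv ∷ [])               [-]             v≢north = (pv , v≢north) ∷ []
  all-nonNorth (pv ∷ pvs@(pw ∷ _))     (v≥w ∷ ordered) v≢north =
    (pv , v≢north) ∷ all-nonNorth pvs ordered (λ { refl → v≢north (slope-≥-north pv v≥w) })

  afterNorths-nonNorth : ∀ ws → All PrimitiveChristoffel ws → Linked SlopeGeq ws → All PrimitiveNonNorth (afterNorths ws)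
  afterNorths-nonNorth []                     _          _       = []
  afterNorths-nonNorth ([] ∷ ws)              prim       ordered = all-nonNorth prim ordered (λ ())
  afterNorths-nonNorth ((false ∷ w) ∷ ws)     prim       ordered = all-nonNorth prim ordered (λ ())
  afterNorths-nonNorth ((true ∷ []) ∷ ws)     (_ ∷ prim) ordered = afterNorths-nonNorth ws prim (Linked.tail ordered)
  afterNorths-nonNorth ((true ∷ b ∷ w) ∷ ws)  prim       ordered = all-nonNorth prim ordered (λ ())

  Linked-north-block : ∀ k {vs} → Linked SlopeGeq vs → Linked SlopeGeq (replicate k north ++ vs)
  Linked-north-block zero    ordered = ordered
  Linked-north-block (suc k) ordered = north∷ Linked-north-block k ordered
    where
    north∷_ : ∀ {vs} → Linked SlopeGeq vs → Linked SlopeGeq (north ∷ vs)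
    north∷ []                       = [-]
    north∷ ordered@([-] {v})        = north-slope-≥ v ∷ ordered
    north∷ ordered@(_∷_ {v} _ _)    = north-slope-≥ v ∷ ordered

  all-north-NWConvex : ∀ n → NWConvex n (replicate n north)
  all-north-NWConvex n =
    All.replicate⁺ n primitive-north ,
    subst (Linked SlopeGeq) (++-identityʳ (replicate n north)) (Linked-north-block n []) ,
    trans (sum-map-replicate length n north) (*-identityʳ n)

  -- The mirror image of north would be east, which is not primitive (q = 0), so the leading block is kept.
  reflect : List Word → List Word
  reflect ws = replicate (leadingNorths ws) north ++ reverse (map mirror (afterNorths ws))

  sum-map-reflect : ∀ (f : Word → ℕ) ws →
                    sum (map f (reflect ws)) ≡ leadingNorths ws * f north + sum (map (λ w → f (mirror w)) (afterNorths ws))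
  sum-map-reflect f ws = begin
    sum (map f (reflect ws))                                      ≡⟨ sum-map-++ f (replicate k north) _ ⟩
    sum (map f (replicate k north)) + sum (map f (reverse (map mirror (afterNorths ws))))
                                                                  ≡⟨ cong₂ _+_ (sum-map-replicate f k north) mirrored ⟩
    k * f north + sum (map (λ w → f (mirror w)) (afterNorths ws)) ∎
    where
    open ≡-Reasoning
    k = leadingNorths ws
    mirrored : sum (map f (reverse (map mirror (afterNorths ws)))) ≡ sum (map (λ w → f (mirror w)) (afterNorths ws))
    mirrored = trans (sum-map-reverse f (map mirror (afterNorths ws))) (sum-map-∘ f mirror (afterNorths ws))

  endX-reflect+leadingNorths : ∀ ws → endX (reflect ws) + leadingNorths ws ≡ endY ws
  endX-reflect+leadingNorths ws = begin
    endX (reflect ws) + k                                      ≡⟨ cong (_+ k) (sum-map-reflect xs ws) ⟩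
    k * 0 + sum (map (λ w → xs (mirror w)) (afterNorths ws)) + k
                                                               ≡⟨ cong (λ x → k * 0 + x + k) (sum-map-cong xs-mirror (afterNorths ws)) ⟩
    k * 0 + endY (afterNorths ws) + k                          ≡⟨ cong (λ x → x + endY (afterNorths ws) + k) (*-zeroʳ k) ⟩
    endY (afterNorths ws) + k                                  ≡⟨ +-comm (endY (afterNorths ws)) k ⟩
    k + endY (afterNorths ws)                                  ≡⟨ cong (_+ endY (afterNorths ws)) (*-identityʳ k) ⟨
    k * 1 + endY (afterNorths ws)                              ≡⟨ sum-map-north-block ys ws ⟨
    endY ws                                                    ∎
    where
    open ≡-Reasoning
    k = leadingNorths ws

  size-reflect : ∀ ws → sum (map length (reflect ws)) ≡ sum (map length ws)
  size-reflect ws = begin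
    sum (map length (reflect ws))                                  ≡⟨ sum-map-reflect length ws ⟩
    k * 1 + sum (map (λ w → length (mirror w)) (afterNorths ws))   ≡⟨ cong (k * 1 +_) (sum-map-cong length-mirror (afterNorths ws)) ⟩
    k * 1 + sum (map length (afterNorths ws))                      ≡⟨ sum-map-north-block length ws ⟨
    sum (map length ws)                                            ∎
    where
    open ≡-Reasoning
    k = leadingNorths ws

  reflect-NWConvex : ∀ {n ws} → NWConvex n ws → NWConvex n (reflect ws)
  reflect-NWConvex {n} {ws} (prim , ordered , size) =
    All.++⁺ (All.replicate⁺ (leadingNorths ws) primitive-north)
            (All-resp-↭ (↭-sym (↭-reverse _)) (All.map⁺ (All.map (λ (pw , w≢north) → primitive-mirror pw w≢north) nonNorth))) ,
    Linked-north-block (leadingNorths ws)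
      (Linked-reverse (Linked.map⁺ (Linked.map (λ {u} {v} → mirror-slope {u} {v}) (Linked-drop (leadingNorths ws) ordered)))) ,
    trans (size-reflect ws) size
    where nonNorth = afterNorths-nonNorth ws prim ordered

  reverse-map-mirror-involutive : ∀ vs → reverse (map mirror (reverse (map mirror vs))) ≡ vs
  reverse-map-mirror-involutive vs = begin
    reverse (map mirror (reverse (map mirror vs))) ≡⟨ cong reverse (reverse-map mirror (map mirror vs)) ⟩
    reverse (reverse (map mirror (map mirror vs))) ≡⟨ reverse-involutive _ ⟩
    map mirror (map mirror vs)                     ≡⟨ map-∘ vs ⟨
    map (λ v → mirror (mirror v)) vs               ≡⟨ map-cong mirror-involutive vs ⟩
    map (λ v → v) vs                               ≡⟨ map-id vs ⟩
    vs                                             ∎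
    where open ≡-Reasoning

  reflect-involutive : ∀ {n ws} → NWConvex n ws → reflect (reflect ws) ≡ ws
  reflect-involutive {n} {ws} (prim , ordered , _) = begin
    reflect (reflect ws)                          ≡⟨ cong₂ (λ k vs → replicate k north ++ reverse (map mirror vs))
                                                           (proj₁ split) (proj₂ split) ⟩
    replicate k north ++ reverse (map mirror rs)  ≡⟨ cong (replicate k north ++_) (reverse-map-mirror-involutive (afterNorths ws)) ⟩
    replicate k north ++ afterNorths ws           ≡⟨ north-block++afterNorths ws ⟩
    ws                                            ∎
    where
    open ≡-Reasoning
    k = leadingNorths ws
    rs = reverse (map mirror (afterNorths ws))
    split = split-north-block k {rs} (All-resp-↭ (↭-sym (↭-reverse _))
              (All.map⁺ (All.map (λ (pw , _) → mirror-≢-north pw) (afterNorths-nonNorth ws prim ordered))))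

  sum-endX+sum-leadingNorths≡sum-endY : ∀ {n L} → Enumerates n L →
                                        sum (map endX L) + sum (map leadingNorths L) ≡ sum (map endY L)
  sum-endX+sum-leadingNorths≡sum-endY {n} {L} (unique , enumerates) = begin
    sum (map endX L) + sum (map leadingNorths L)                        ≡⟨ cong (_+ sum (map leadingNorths L)) reflect-invariant ⟨
    sum (map (λ ws → endX (reflect ws)) L) + sum (map leadingNorths L)  ≡⟨ sum-map-+ (λ ws → endX (reflect ws)) leadingNorths L ⟨
    sum (map (λ ws → endX (reflect ws) + leadingNorths ws) L)           ≡⟨ sum-map-cong endX-reflect+leadingNorths L ⟩
    sum (map endY L)                                                    ∎
    where
    open ≡-Reasoning
    nw : ∀ {ws} → ws ∈ L → NWConvex n ws
    nw = proj₁ (enumerates _)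
    reflect-↭ : map reflect L ↭ L
    reflect-↭ = map-involution-↭ unique (λ ws∈L → proj₂ (enumerates _) (reflect-NWConvex (nw ws∈L)))
                                         (λ ws∈L → reflect-involutive (nw ws∈L))
    reflect-invariant : sum (map (λ ws → endX (reflect ws)) L) ≡ sum (map endX L)
    reflect-invariant = trans (sym (sum-map-∘ endX reflect L)) (sum-↭ (↭.map⁺ endX reflect-↭))

  endX+endY≡size : ∀ ws → endX ws + endY ws ≡ sum (map length ws)
  endX+endY≡size ws = trans (sym (sum-map-+ xs ys ws)) (sum-map-cong xs+ys≡length ws)

  sum-endX+sum-endY≡total : ∀ {n L} → Enumerates n L → sum (map endX L) + sum (map endY L) ≡ length L * n
  sum-endX+sum-endY≡total {n} {L} (_ , enumerates) = begin
    sum (map endX L) + sum (map endY L)     ≡⟨ sum-map-+ endX endY L ⟨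
    sum (map (λ ws → endX ws + endY ws) L)  ≡⟨ sum-map-cong-∈ L (λ {ws} ws∈L → trans (endX+endY≡size ws) (size-of ws∈L)) ⟩
    sum (map (λ _ → n) L)                   ≡⟨ sum-map-const n L ⟩
    length L * n                            ∎
    where
    open ≡-Reasoning
    size-of : ∀ {ws} → ws ∈ L → sum (map length ws) ≡ n
    size-of {ws} ws∈L = proj₂ (proj₂ (proj₁ (enumerates ws) ws∈L))

  -- Trading a vertical block for a single east step

  _≟w_ : (u v : Word) → Dec (u ≡ v)
  _≟w_ = ≡-dec Bool._≟_

  open import Data.List.Membership.DecPropositional _≟w_ using (_∈?_)

  insertBySlope : Word → List Word → List Word
  insertBySlope u []       = u ∷ []
  insertBySlope u (v ∷ vs) with ys u * xs v <? ys v * xs u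
  ... | yes _ = v ∷ insertBySlope u vs
  ... | no _  = u ∷ v ∷ vs

  delete : Word → List Word → List Word
  delete u []       = []
  delete u (v ∷ vs) with v ≟w u
  ... | yes _ = vs
  ... | no _  = v ∷ delete u vs

  delete-insertBySlope : ∀ u vs → delete u (insertBySlope u vs) ≡ vs
  delete-insertBySlope u [] with u ≟w u
  ... | yes _   = refl
  ... | no u≢u  = ⊥-elim (u≢u refl)
  delete-insertBySlope u (v ∷ vs) with ys u * xs v <? ys v * xs u
  ... | yes u<v with v ≟w u
  ...   | yes refl = ⊥-elim (<-irrefl refl u<v)
  ...   | no _     = cong (v ∷_) (delete-insertBySlope u vs)
  delete-insertBySlope u (v ∷ vs) | no _ with u ≟w u
  ...   | yes _   = refl
  ...   | no u≢u  = ⊥-elim (u≢u refl)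

  ∈-insertBySlope : ∀ u vs → u ∈ insertBySlope u vs
  ∈-insertBySlope u []       = here refl
  ∈-insertBySlope u (v ∷ vs) with ys u * xs v <? ys v * xs u
  ... | yes _ = there (∈-insertBySlope u vs)
  ... | no _  = here refl

  All-insertBySlope : ∀ {P : Word → Set} {u vs} → P u → All P vs → All P (insertBySlope u vs)
  All-insertBySlope {u = u} {[]}     pu _          = pu ∷ []
  All-insertBySlope {u = u} {v ∷ vs} pu (pv ∷ pvs) with ys u * xs v <? ys v * xs u
  ... | yes _ = pv ∷ All-insertBySlope pu pvs
  ... | no _  = pu ∷ pv ∷ pvs

  Linked-insertBySlope : ∀ u {vs} → Linked SlopeGeq vs → Linked SlopeGeq (insertBySlope u vs)
  Linked-insertBySlope u {[]}     _       = [-]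
  Linked-insertBySlope u {v ∷ vs} ordered with ys u * xs v <? ys v * xs u
  ... | yes u<v = below v u<v ordered
    where
    below : ∀ v {vs} → ys u * xs v < ys v * xs u → Linked SlopeGeq (v ∷ vs) → Linked SlopeGeq (v ∷ insertBySlope u vs)
    below v {[]}     u<v _               = <⇒≤ u<v ∷ [-]
    below v {w ∷ vs} u<v (v≥w ∷ ordered) with ys u * xs w <? ys w * xs u
    ... | yes u<w = v≥w ∷ below w u<w ordered
    ... | no u≮w  = <⇒≤ u<v ∷ ≮⇒≥ u≮w ∷ ordered
  ... | no u≮v  = ≮⇒≥ u≮v ∷ ordered

  size-insertBySlope : ∀ u vs → sum (map length (insertBySlope u vs)) ≡ length u + sum (map length vs)
  size-insertBySlope u []       = refl
  size-insertBySlope u (v ∷ vs) with ys u * xs v <? ys v * xs u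
  ... | yes _ = trans (cong (length v +_) (size-insertBySlope u vs)) (x∙yz≈y∙xz (length v) (length u) _)
  ... | no _  = refl

  replaceNorths : ℕ → List Word → List Word
  replaceNorths j ws = insertBySlope (eastThenNorth j) (drop (2 + j) ws)

  restoreNorths : ℕ → List Word → List Word
  restoreNorths j vs = replicate (2 + j) north ++ delete (eastThenNorth j) vs

  restore-replaceNorths : ∀ j ws → 2 + j ≤ leadingNorths ws → restoreNorths j (replaceNorths j ws) ≡ ws
  restore-replaceNorths j ws tall =
    trans (cong (replicate (2 + j) north ++_) (delete-insertBySlope (eastThenNorth j) (drop (2 + j) ws)))
          (north-block++drop (2 + j) ws tall)

  replaceNorths-NWConvex : ∀ {n} j ws → 2 + j ≤ leadingNorths ws → NWConvex n ws → NWConvex n (replaceNorths j ws)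
  replaceNorths-NWConvex {n} j ws tall (prim , ordered , size) =
    All-insertBySlope (primitive-eastThenNorth j) (All.drop⁺ (2 + j) prim) ,
    Linked-insertBySlope (eastThenNorth j) (Linked-drop (2 + j) ordered) ,
    (begin
      sum (map length (replaceNorths j ws))                             ≡⟨ size-insertBySlope (eastThenNorth j) rs ⟩
      length (eastThenNorth j) + sum (map length rs)                    ≡⟨ cong (_+ sum (map length rs)) block-size ⟩
      sum (map length (replicate (2 + j) north)) + sum (map length rs)  ≡⟨ sum-map-++ length (replicate (2 + j) north) rs ⟨
      sum (map length (replicate (2 + j) north ++ rs))                  ≡⟨ cong (λ vs → sum (map length vs)) (north-block++drop (2 + j) ws tall) ⟩
      sum (map length ws)                                               ≡⟨ size ⟩
      n                                                                 ∎)
    where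
    open ≡-Reasoning
    rs = drop (2 + j) ws
    block-size : length (eastThenNorth j) ≡ sum (map length (replicate (2 + j) north))
    block-size = trans (length-eastThenNorth j) (sym (trans (sum-map-replicate length (2 + j) north) (*-identityʳ (2 + j))))

  count-tall-≤-count-eastThenNorth : ∀ {n L} → Enumerates n L → ∀ j →
    sum (map (λ ws → 𝟙 (j <? pred (leadingNorths ws))) L) ≤ sum (map (λ ws → 𝟙 (eastThenNorth j ∈? ws)) L)
  count-tall-≤-count-eastThenNorth {n} {L} (unique , enumerates) j =
    count-≤-injection (λ ws → j <? pred (leadingNorths ws)) (λ ws → eastThenNorth j ∈? ws) (replaceNorths j) (restoreNorths j) unique
      λ {ws} ws∈L j<leadingNorths-1 →
        let tall = <pred⇒2+≤ (leadingNorths ws) j<leadingNorths-1 in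
        proj₂ (enumerates _) (replaceNorths-NWConvex j ws tall (proj₁ (enumerates ws) ws∈L)) ,
        ∈-insertBySlope (eastThenNorth j) (drop (2 + j) ws) ,
        restore-replaceNorths j ws tall
    where
    <pred⇒2+≤ : ∀ l → j < pred l → 2 + j ≤ l
    <pred⇒2+≤ (suc l) j<l = s≤s j<l

  -- Bounding the leading blocks

  sum-members≤sum : ∀ (f : Word → ℕ) ws {vs} → Unique vs → sum (map (λ v → 𝟙 (v ∈? ws) * f v) vs) ≤ sum (map f ws)
  sum-members≤sum f ws {vs} unique = begin
    sum (map (λ v → 𝟙 (v ∈? ws) * f v) vs) ≡⟨ sum-𝟙*≡sum-filter (_∈? ws) f vs ⟩
    sum (map f (filter (_∈? ws) vs))       ≤⟨ sum-map-mono-⊆ f (Unique.filter⁺ (_∈? ws) unique)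
                                                               (proj₂ ∘ ∈-filter⁻ (_∈? ws) {xs = vs}) ⟩
    sum (map f ws)                         ∎
    where open ≤-Reasoning

  leadingNorths≤size : ∀ {n ws} → NWConvex n ws → leadingNorths ws ≤ n
  leadingNorths≤size {n} {ws} (_ , _ , size) = begin
    k                                          ≡⟨ *-identityʳ k ⟨
    k * 1                                      ≤⟨ m≤m+n (k * 1) _ ⟩
    k * 1 + sum (map length (afterNorths ws))  ≡⟨ sum-map-north-block length ws ⟨
    sum (map length ws)                        ≡⟨ size ⟩
    n                                          ∎
    where
    open ≤-Reasoning
    k = leadingNorths ws

  singleEastCount : ℕ → List Word → ℕ
  singleEastCount n ws = sum (map (λ j → 𝟙 (eastThenNorth j ∈? ws)) (downFrom n))

  -- Count the pairs (ws, j) with 2 + j ≤ leadingNorths ws by j instead of by ws, and trade them via replaceNorths j.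
  sum-leadingNorths≤ : ∀ {n L} → Enumerates n L → sum (map leadingNorths L) ≤ sum (map (λ ws → suc (singleEastCount n ws)) L)
  sum-leadingNorths≤ {n} {L} enum@(_ , enumerates) = begin
    sum (map leadingNorths L)
      ≤⟨ sum-map-mono L (λ {ws} ws∈L → leadingNorths≤1+count (leadingNorths ws)
                                         (leadingNorths≤size (proj₁ (enumerates ws) ws∈L))) ⟩
    sum (map (λ ws → 1 + sum (map (tall ws) (downFrom n))) L)
      ≡⟨ sum-map-+ (λ _ → 1) (λ ws → sum (map (tall ws) (downFrom n))) L ⟩
    sum (map (λ _ → 1) L) + sum (map (λ ws → sum (map (tall ws) (downFrom n))) L)
      ≡⟨ cong (sum (map (λ _ → 1) L) +_) (sum-map-swap tall L (downFrom n)) ⟩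
    sum (map (λ _ → 1) L) + sum (map (λ j → sum (map (λ ws → tall ws j) L)) (downFrom n))
      ≤⟨ +-monoʳ-≤ (sum (map (λ _ → 1) L)) (sum-map-mono (downFrom n) (λ {j} _ → count-tall-≤-count-eastThenNorth enum j)) ⟩
    sum (map (λ _ → 1) L) + sum (map (λ j → sum (map (λ ws → single ws j) L)) (downFrom n))
      ≡⟨ cong (sum (map (λ _ → 1) L) +_) (sum-map-swap single L (downFrom n)) ⟨
    sum (map (λ _ → 1) L) + sum (map (singleEastCount n) L)
      ≡⟨ sum-map-+ (λ _ → 1) (singleEastCount n) L ⟨
    sum (map (λ ws → suc (singleEastCount n ws)) L) ∎
    where
    open ≤-Reasoning
    tall : List Word → ℕ → ℕ
    tall ws j = 𝟙 (j <? pred (leadingNorths ws))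
    single : List Word → ℕ → ℕ
    single ws j = 𝟙 (eastThenNorth j ∈? ws)
    leadingNorths≤1+count : ∀ l → l ≤ n → l ≤ suc (sum (map (λ j → 𝟙 (j <? pred l)) (downFrom n)))
    leadingNorths≤1+count zero    _   = z≤n
    leadingNorths≤1+count (suc l) l<n = s≤s (≤-reflexive (sym (trans (count-<-downFrom n l) (m≥n⇒m⊓n≡n (<⇒≤ l<n)))))

  -- The distinct words eastThenNorth j with q ≤ j are longer than q and fit into a path of size n.
  *-singleEastCount≤ : ∀ q {n ws} → NWConvex n ws → q * singleEastCount n ws ≤ q * q + n
  *-singleEastCount≤ q {n} {ws} (_ , _ , size) = begin
    q * singleEastCount n ws
      ≡⟨ sum-map-*ˡ q member (downFrom n) ⟨
    sum (map (λ j → q * member j) (downFrom n))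
      ≤⟨ sum-map-mono (downFrom n) (λ {j} _ → pointwise j) ⟩
    sum (map (λ j → q * 𝟙 (j <? q) + member j * length (eastThenNorth j)) (downFrom n))
      ≡⟨ sum-map-+ (λ j → q * 𝟙 (j <? q)) (λ j → member j * length (eastThenNorth j)) (downFrom n) ⟩
    sum (map (λ j → q * 𝟙 (j <? q)) (downFrom n)) + sum (map (λ j → member j * length (eastThenNorth j)) (downFrom n))
      ≤⟨ +-mono-≤ short long ⟩
    q * q + n ∎
    where
    open ≤-Reasoning
    member : ℕ → ℕ
    member j = 𝟙 (eastThenNorth j ∈? ws)
    pointwise : ∀ j → q * member j ≤ q * 𝟙 (j <? q) + member j * length (eastThenNorth j)
    pointwise j with eastThenNorth j ∈? ws | j <? q
    ... | no _  | _       = ≤-trans (≤-reflexive (*-zeroʳ q)) z≤n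
    ... | yes _ | yes _   = m≤m+n (q * 1) _
    ... | yes _ | no j≮q  = begin
      q * 1                                 ≡⟨ *-identityʳ q ⟩
      q                                     ≤⟨ ≮⇒≥ j≮q ⟩
      j                                     ≤⟨ m≤n+m j 2 ⟩
      2 + j                                 ≡⟨ length-eastThenNorth j ⟨
      length (eastThenNorth j)              ≡⟨ *-identityˡ _ ⟨
      1 * length (eastThenNorth j)          ≤⟨ m≤n+m _ (q * 0) ⟩
      q * 0 + 1 * length (eastThenNorth j)  ∎
    short : sum (map (λ j → q * 𝟙 (j <? q)) (downFrom n)) ≤ q * q
    short = begin
      sum (map (λ j → q * 𝟙 (j <? q)) (downFrom n)) ≡⟨ sum-map-*ˡ q (λ j → 𝟙 (j <? q)) (downFrom n) ⟩
      q * sum (map (λ j → 𝟙 (j <? q)) (downFrom n)) ≡⟨ cong (q *_) (count-<-downFrom n q) ⟩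
      q * (n ⊓ q)                                    ≤⟨ *-monoʳ-≤ q (m⊓n≤n n q) ⟩
      q * q                                          ∎
    long : sum (map (λ j → member j * length (eastThenNorth j)) (downFrom n)) ≤ n
    long = begin
      sum (map (λ j → member j * length (eastThenNorth j)) (downFrom n))
        ≡⟨ sum-map-∘ (λ v → 𝟙 (v ∈? ws) * length v) eastThenNorth (downFrom n) ⟨
      sum (map (λ v → 𝟙 (v ∈? ws) * length v) (map eastThenNorth (downFrom n)))
        ≤⟨ sum-members≤sum length ws (Unique.map⁺ eastThenNorth-injective (Unique.downFrom⁺ n)) ⟩
      sum (map length ws)
        ≡⟨ size ⟩
      n ∎

  *-sum-leadingNorths≤ : ∀ q {n L} → Enumerates n L → q * sum (map leadingNorths L) ≤ length L * (q + (q * q + n))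
  *-sum-leadingNorths≤ q {n} {L} enum@(_ , enumerates) = begin
    q * sum (map leadingNorths L)                        ≤⟨ *-monoʳ-≤ q (sum-leadingNorths≤ enum) ⟩
    q * sum (map (λ ws → suc (singleEastCount n ws)) L)  ≡⟨ sum-map-*ˡ q (λ ws → suc (singleEastCount n ws)) L ⟨
    sum (map (λ ws → q * suc (singleEastCount n ws)) L)  ≤⟨ sum-map-mono L per-path ⟩
    sum (map (λ _ → q + (q * q + n)) L)                  ≡⟨ sum-map-const (q + (q * q + n)) L ⟩
    length L * (q + (q * q + n))                         ∎
    where
    open ≤-Reasoning
    per-path : ∀ {ws} → ws ∈ L → q * suc (singleEastCount n ws) ≤ q + (q * q + n)
    per-path {ws} ws∈L = ≤-trans (≤-reflexive (*-suc q _))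
      (+-monoʳ-≤ q (*-singleEastCount≤ q (proj₁ (enumerates ws) ws∈L)))

  *-sum-leadingNorths< : ∀ q {n L} → Enumerates n L → q + q * q < n → q * sum (map leadingNorths L) < 2 * (length L * n)
  *-sum-leadingNorths< q {n} {L} enum@(_ , enumerates) q+q²<n = begin-strict
    q * sum (map leadingNorths L)  ≤⟨ *-sum-leadingNorths≤ q enum ⟩
    length L * (q + (q * q + n))   <⟨ *-monoʳ-< (length L) {{nonEmpty}}
                                        (≤-trans (≤-reflexive (cong suc (sym (+-assoc q (q * q) n)))) (+-monoˡ-< n q+q²<n)) ⟩
    length L * (n + n)             ≡⟨ cong (length L *_) (cong (n +_) (sym (+-identityʳ n))) ⟩
    length L * (2 * n)             ≡⟨ x*yz≡y*xz (length L) 2 n ⟩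
    2 * (length L * n)             ∎
    where
    open ≤-Reasoning
    nonEmpty : NonZero (length L)
    nonEmpty with proj₂ (enumerates (replicate n north)) (all-north-NWConvex n)
    ... | here _  = _
    ... | there _ = _

module HalfDeviation where
  open import Data.Nat using (ℕ; zero; suc; _+_; _*_; _≤_; _<_; s≤s; z≤n)
  import Data.Nat.Properties as ℕ
  open import Data.Integer as ℤ using (+_; -[1+_]; +<+)
  import Data.Integer.Properties as ℤ
  import Data.Integer.Tactic.RingSolver as ℤ-Solver
  open import Data.Rational using (mkℚ; 0ℚ; ½; ∣_∣; toℚᵘ; *<*) renaming (_*_ to _*ℚ_; _-_ to _-ℚ_)
  import Data.Rational as ℚ
  import Data.Rational.Properties as ℚ
  open import Data.Rational.Unnormalised as ℚᵘ using (mkℚᵘ)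
  import Data.Rational.Unnormalised.Properties as ℚᵘ
  import Data.Nat.Coprimality as Coprime
  open import Data.Product using (∃-syntax; _×_; _,_)
  open import Relation.Binary.PropositionalEquality

  -- Both sides unfold to integer fractions, so this is an inequality between integers.
  half-deviation<ᵘ : ∀ a t k p d → ℤ.∣ + a ℤ.* + 2 ℤ.- + t ∣ ≡ k → suc d * k < 2 * t → 1 ≤ p →
    ℚᵘ.∣ mkℚᵘ (+ a) 0 ℚᵘ.- mkℚᵘ (+ 1) 1 ℚᵘ.* mkℚᵘ (+ t) 0 ∣ ℚᵘ.< mkℚᵘ (+ p) d ℚᵘ.* mkℚᵘ (+ t) 0
  half-deviation<ᵘ a t k p d ∣num∣≡k qk<2t 1≤p = ℚᵘ.*<* (subst₂ ℤ._<_
    (cong₂ ℤ._*_ (cong +_ (trans (sym ∣num∣≡k) (cong ℤ.∣_∣ (sym (numerator (+ a) (+ t))))))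
                 (cong +_ (sym (ℕ.*-identityʳ (suc d)))))
    (cong (ℤ._* + 2) (ℤ.pos-* p t))
    (subst₂ ℤ._<_ (ℤ.pos-* k (suc d)) (ℤ.pos-* (p * t) 2) (+<+ kq<pt2)))
    where
    numerator : ∀ a t → a ℤ.* + 2 ℤ.+ ℤ.- (+ 1 ℤ.* t) ℤ.* + 1 ≡ a ℤ.* + 2 ℤ.- t
    numerator = ℤ-Solver.solve-∀
    kq<pt2 : k * suc d < p * t * 2
    kq<pt2 = ℕ.<-≤-trans (subst₂ _<_ (ℕ.*-comm (suc d) k) (ℕ.*-comm 2 t) qk<2t)
               (ℕ.*-monoˡ-≤ 2 (subst (_≤ p * t) (ℕ.*-identityˡ t) (ℕ.*-monoˡ-≤ t 1≤p)))

  toℚᵘ-ℕtoℚ : ∀ m → toℚᵘ (ℕtoℚ m) ℚᵘ.≃ mkℚᵘ (+ m) 0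
  toℚᵘ-ℕtoℚ m = ℚᵘ.≃-reflexive (cong toℚᵘ (ℚ.normalize-coprime {m} {0} (Coprime.sym (Coprime.1-coprimeTo m))))

  deviation<-fromℚᵘ : ∀ a t p d .(c : Coprime.Coprime p (suc d)) →
    ℚᵘ.∣ mkℚᵘ (+ a) 0 ℚᵘ.- mkℚᵘ (+ 1) 1 ℚᵘ.* mkℚᵘ (+ t) 0 ∣ ℚᵘ.< mkℚᵘ (+ p) d ℚᵘ.* mkℚᵘ (+ t) 0 →
    ∣ ℕtoℚ a -ℚ ½ *ℚ ℕtoℚ t ∣ ℚ.< mkℚ (+ p) d c *ℚ ℕtoℚ t
  deviation<-fromℚᵘ a t p d c <ᵘ = ℚ.toℚᵘ-cancel-< (ℚᵘ.<-respʳ-≃ (ℚᵘ.≃-sym rhs) (ℚᵘ.<-respˡ-≃ (ℚᵘ.≃-sym lhs) <ᵘ))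
    where
    open ℚᵘ.≃-Reasoning
    lhs : toℚᵘ ∣ ℕtoℚ a -ℚ ½ *ℚ ℕtoℚ t ∣ ℚᵘ.≃ ℚᵘ.∣ mkℚᵘ (+ a) 0 ℚᵘ.- mkℚᵘ (+ 1) 1 ℚᵘ.* mkℚᵘ (+ t) 0 ∣
    lhs = begin
      toℚᵘ ∣ ℕtoℚ a -ℚ ½ *ℚ ℕtoℚ t ∣
        ≈⟨ ℚ.toℚᵘ-homo-∣-∣ _ ⟩
      ℚᵘ.∣ toℚᵘ (ℕtoℚ a -ℚ ½ *ℚ ℕtoℚ t) ∣
        ≈⟨ ℚᵘ.∣-∣-cong (ℚ.toℚᵘ-homo-+ (ℕtoℚ a) _) ⟩
      ℚᵘ.∣ toℚᵘ (ℕtoℚ a) ℚᵘ.+ toℚᵘ (ℚ.- (½ *ℚ ℕtoℚ t)) ∣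
        ≈⟨ ℚᵘ.∣-∣-cong (ℚᵘ.+-cong (toℚᵘ-ℕtoℚ a) (ℚ.toℚᵘ-homo‿- _)) ⟩
      ℚᵘ.∣ mkℚᵘ (+ a) 0 ℚᵘ.- toℚᵘ (½ *ℚ ℕtoℚ t) ∣
        ≈⟨ ℚᵘ.∣-∣-cong (ℚᵘ.+-congʳ (mkℚᵘ (+ a) 0) (ℚᵘ.-‿cong (ℚ.toℚᵘ-homo-* ½ (ℕtoℚ t)))) ⟩
      ℚᵘ.∣ mkℚᵘ (+ a) 0 ℚᵘ.- toℚᵘ ½ ℚᵘ.* toℚᵘ (ℕtoℚ t) ∣
        ≈⟨ ℚᵘ.∣-∣-cong (ℚᵘ.+-congʳ (mkℚᵘ (+ a) 0) (ℚᵘ.-‿cong (ℚᵘ.*-congˡ {toℚᵘ ½} (toℚᵘ-ℕtoℚ t)))) ⟩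
      ℚᵘ.∣ mkℚᵘ (+ a) 0 ℚᵘ.- mkℚᵘ (+ 1) 1 ℚᵘ.* mkℚᵘ (+ t) 0 ∣ ∎
    rhs : toℚᵘ (mkℚ (+ p) d c *ℚ ℕtoℚ t) ℚᵘ.≃ mkℚᵘ (+ p) d ℚᵘ.* mkℚᵘ (+ t) 0
    rhs = ℚᵘ.≃-trans (ℚ.toℚᵘ-homo-* (mkℚ (+ p) d c) (ℕtoℚ t)) (ℚᵘ.*-congˡ {mkℚᵘ (+ p) d} (toℚᵘ-ℕtoℚ t))

  -- The witness q is the denominator of ε: then k / 2 < t / q ≤ ε t.
  deviations< : ∀ ε → 0ℚ ℚ.< ε → ∃[ q ] ∀ {x y k t} → x + k ≡ y → x + y ≡ t → q * k < 2 * t →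
    (∣ ℕtoℚ x -ℚ ½ *ℚ ℕtoℚ t ∣ ℚ.< ε *ℚ ℕtoℚ t) ×
    (∣ ℕtoℚ y -ℚ ½ *ℚ ℕtoℚ t ∣ ℚ.< ε *ℚ ℕtoℚ t)
  deviations< (mkℚ (+ zero) d c)    (*<* (+<+ ()))
  deviations< (mkℚ -[1+ _ ] d c)    (*<* ())
  deviations< (mkℚ (+ suc p′) d c) _ = suc d , λ { {x} {k = k} refl refl qk<2t →
    deviation<-fromℚᵘ x _ (suc p′) d c (half-deviation<ᵘ x _ k (suc p′) d (lower x k) qk<2t (s≤s z≤n)) ,
    deviation<-fromℚᵘ (x + k) _ (suc p′) d c (half-deviation<ᵘ (x + k) _ k (suc p′) d (upper x k) qk<2t (s≤s z≤n)) }
    where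
    lower : ∀ x k → ℤ.∣ + x ℤ.* + 2 ℤ.- + (x + (x + k)) ∣ ≡ k
    lower x k = trans (cong ℤ.∣_∣ (lower-identity (+ x) (+ k))) (ℤ.∣-i∣≡∣i∣ (+ k))
      where
      lower-identity : ∀ x k → x ℤ.* + 2 ℤ.- (x ℤ.+ (x ℤ.+ k)) ≡ ℤ.- k
      lower-identity = ℤ-Solver.solve-∀
    upper : ∀ x k → ℤ.∣ + (x + k) ℤ.* + 2 ℤ.- + (x + (x + k)) ∣ ≡ k
    upper x k = cong ℤ.∣_∣ (upper-identity (+ x) (+ k))
      where
      upper-identity : ∀ x k → (x ℤ.+ k) ℤ.* + 2 ℤ.- (x ℤ.+ (x ℤ.+ k)) ≡ k
      upper-identity = ℤ-Solver.solve-∀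

open import Data.Nat using (ℕ; suc; _+_; _*_; _≤_)
open import Data.List using (List; length; map)
open import Data.Nat.ListAction using (sum)
open import Data.Product using (∃-syntax; _×_; _,_)
open import Data.Rational using (ℚ; 0ℚ; ½; _<_; _-_; ∣_∣) renaming (_*_ to _*ℚ_)

open LatticePaths using (sum-endX+sum-leadingNorths≡sum-endY; sum-endX+sum-endY≡total; *-sum-leadingNorths<)
open HalfDeviation using (deviations<)

lemma3 : ∀ (ε : ℚ) → 0ℚ < ε →
         ∃[ N ] (∀ (n : ℕ) → N ≤ n → ∀ (L : List (List Word)) → Enumerates n L →
           (∣ ℕtoℚ (sum (map endX L)) - ½ *ℚ ℕtoℚ (length L * n) ∣ < ε *ℚ ℕtoℚ (length L * n))
           × (∣ ℕtoℚ (sum (map endY L)) - ½ *ℚ ℕtoℚ (length L * n) ∣ < ε *ℚ ℕtoℚ (length L * n)))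
lemma3 ε 0<ε with deviations< ε 0<ε
... | q , deviation = suc (q + q * q) , λ n q+q²<n L enum →
  deviation (sum-endX+sum-leadingNorths≡sum-endY enum) (sum-endX+sum-endY≡total enum) (*-sum-leadingNorths< q enum q+q²<n)
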